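{- For every PPC data structure $t$, there exists a reduction $t \rightarrow_{\bullet}^* t'$ such that $t'$ is a $PPC_\bullet$ data structure.
   Context: PPC (Pure Pattern Calculus) terms are given by $t ::= x \mid \hat{x} \mid t\,t \mid [\theta]\,t \to t$, where $x$ is a variable occurrence, $\hat{x}$ a matchable occurrence of the name $x$, and $[\theta]\,p \to b$ an abstraction over a pattern $p$ binding the list of names $\theta$. PPC data structures are given by $d ::= \hat{x} \mid d\,t$. The calculus $PPC_\bullet$ extends PPC terms with an explicit structural application: $t ::= x \mid \hat{x} \mid t\,t \mid t \bullet t \mid [\theta]\,t \to t$, and $PPC_\bullet$ data structures are $d ::= \hat{x} \mid t \bullet t$. The reduction $\rightarrow_{\bullet}$ is generated (in any context) by the two rules $\hat{x}\ t \rightarrow_{\bullet} \hat{x} \bullet t$ and $(t_1 \bullet t_2)\ t_3 \rightarrow_{\bullet} (t_1 \bullet t_2) \bullet t_3$. PPC embeds into $PPC_\bullet$ by the identity, so a PPC term is regarded as a $PPC_\bullet$ term (a "pure" term). -}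

module Defs where

open import Data.Nat using (ℕ)
open import Data.List using (List)
open import Relation.Binary.Construct.Closure.ReflexiveTransitive using (Star)

Name : Set
Name = ℕ

-- PPC• terms:  t ::= x | x̂ | t t | t • t | [θ] t → t
data Term : Set where
  var   : Name → Term
  mvar  : Name → Term
  app   : Term → Term → Term
  sapp  : Term → Term → Term
  abs   : List Name → Term → Term → Term

-- Pure terms: the image of the PPC terms (no structural application).
data Pure : Term → Set where
  var  : ∀ x → Pure (var x)
  mvar : ∀ x → Pure (mvar x)
  app  : ∀ {t u} → Pure t → Pure u → Pure (app t u)
  abs  : ∀ θ {p b} → Pure p → Pure b → Pure (abs θ p b)

data PPCData : Term → Set where
  mvar : ∀ x → PPCData (mvar x)
  app  : ∀ {d t} → PPCData d → Pure t → PPCData (app d t)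

data BulletData : Term → Set where
  mvar : ∀ x → BulletData (mvar x)
  sapp : ∀ t u → BulletData (sapp t u)

infix 4 _⟶•_
data _⟶•_ : Term → Term → Set where
  ruleM  : ∀ x t → app (mvar x) t ⟶• sapp (mvar x) t
  ruleS  : ∀ t₁ t₂ t₃ → app (sapp t₁ t₂) t₃ ⟶• sapp (sapp t₁ t₂) t₃
  appL   : ∀ {t t'} u → t ⟶• t' → app t u ⟶• app t' u
  appR   : ∀ t {u u'} → u ⟶• u' → app t u ⟶• app t u'
  sappL  : ∀ {t t'} u → t ⟶• t' → sapp t u ⟶• sapp t' u
  sappR  : ∀ t {u u'} → u ⟶• u' → sapp t u ⟶• sapp t u'
  absP   : ∀ θ {p p'} b → p ⟶• p' → abs θ p b ⟶• abs θ p' b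
  absB   : ∀ θ p {b b'} → b ⟶• b' → abs θ p b ⟶• abs θ p b'

infix 4 _⟶•*_
_⟶•*_ : Term → Term → Set
_⟶•*_ = Star _⟶•_

-- Induction on the spine d t₁ … tₙ: once the head d has become a PPC• data
-- structure, one more step turns d t into the structural application d • t.
module Submission where

open import Defs
open import Data.Product using (Σ; _×_; _,_)
open import Relation.Binary.Construct.Closure.ReflexiveTransitive using (ε; _◅_; _◅◅_; gmap)

app-cong-⟶•*ˡ : ∀ {t t'} u → t ⟶•* t' → app t u ⟶•* app t' u
app-cong-⟶•*ˡ u = gmap (λ t → app t u) (appL u)

app⟶•sapp : ∀ {d} u → BulletData d → app d u ⟶• sapp d u
app⟶•sapp u (mvar x)   = ruleM x u
app⟶•sapp u (sapp a b) = ruleS a b u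

-- The arguments of a PPC data structure need not be pure for this to hold.
mainTheorem3 : (t : Term) → PPCData t → Σ Term (λ t' → (t ⟶•* t') × BulletData t')
mainTheorem3 .(mvar x) (mvar x) = mvar x , ε , mvar x
mainTheorem3 (app d u) (app d-data _) with mainTheorem3 d d-data
... | d' , d⟶•*d' , d'-data =
  sapp d' u , app-cong-⟶•*ˡ u d⟶•*d' ◅◅ app⟶•sapp u d'-data ◅ ε , sapp d' u
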